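{- In the batched dynamic network model described in the context, allowing node insertions, edge insertions, node deletions and edge deletions, the deterministic $1$-round bandwidth complexity of $\mathsf{BatchedList}(K_3)$ is $O(\log n)$, where $n$ is the current number of nodes. That is, there is a deterministic algorithm in which each node sends each neighbor $O(\log n)$ bits per round, and after the single round of communication following each batch of updates every triangle of the current graph is listed by at least one of its nodes and no set of three nodes that is not a triangle of the current graph is listed.
   Context: Batched dynamic network model: the network is a sequence of graphs $(G_0, G_1, \dots, G_r)$, $G_i=(V_i,E_i)$. All nodes of $G_0$ know its complete topology. $G_i$ is obtained from $G_{i-1}$ by a batch of updates (node insertions together with their incident edges, node deletions together with their incident edges, edge insertions, edge deletions) such that every node of $V_i$ is incident to at most $O(1)$ updates; in particular a newly inserted node $u\in V_i\setminus V_{i-1}$ has only newly inserted incident edges, hence $O(1)$ of them. Each node has a unique ID of $O(\log n)$ bits ($n$ the current number of nodes) and knows the IDs of its current neighbors. Communication is synchronous; each round: (1) the batch of updates occurs and each node learns its new neighbor list; (2) each node sends each of its current neighbors a message of at most $B$ bits (the bandwidth); (3) nodes receive messages and output their lists. Deleted nodes send and list nothing. $K_3$ is the triangle. $\mathsf{BatchedList}(H)$ is the problem, in this model, that in each round every subgraph of the current graph isomorphic to $H$ is listed (IDs of its nodes output) by at least one of its nodes, and every listed set is such a subgraph. The deterministic $1$-round bandwidth complexity is the minimum $B$ for which a deterministic algorithm has correct output at every node after one round of communication following each batch. -}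

module Defs where

open import Data.Nat using (ℕ; zero; suc; _+_; _*_; _^_; _<_; _≤_; _≡ᵇ_)
open import Data.Nat.Logarithm using (⌈log₂_⌉)
open import Data.Bool using (Bool; true; false; T; if_then_else_; _xor_; not; _∧_)
open import Data.List using (List; []; _∷_; length; filterᵇ)
open import Data.Bool.ListAction using (any)
open import Data.List.Membership.Propositional using (_∈_)
open import Data.List.Relation.Unary.Linked using (Linked)
open import Data.Product using (_×_; _,_; Σ; ∃; ∃-syntax)
open import Data.Sum using (_⊎_)
open import Relation.Binary.PropositionalEquality using (_≡_)

-- V is the node set, listed in strictly increasing order (so without
-- duplicates and in a canonical order); adj is a symmetric, irreflexive
-- adjacency relation supported on V.

inList : ℕ → List ℕ → Bool
inList v xs = any (λ w → v ≡ᵇ w) xs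

record Graph : Set where
  field
    V      : List ℕ
    sorted : Linked _<_ V
    adj    : ℕ → ℕ → Bool
    sym    : ∀ u v → adj u v ≡ adj v u
    irrefl : ∀ u → adj u u ≡ false
    adj-V  : ∀ u v → T (adj u v) → T (inList u V)

open Graph public

inV : Graph → ℕ → Bool
inV G v = inList v (V G)

size : Graph → ℕ
size G = length (V G)

nbrs : Graph → ℕ → List ℕ
nbrs G u = filterᵇ (adj G u) (V G)

-- The batch turning G into G' is the difference
-- between them: inserted / deleted nodes and inserted / deleted edges
-- (edges of deleted nodes are deleted with them, edges of inserted nodes
-- are inserted with them).

changed : Graph → Graph → ℕ → ℕ → Bool
changed G G' u w = adj G u w xor adj G' u w

updatesAt : Graph → Graph → ℕ → ℕ
updatesAt G G' u =
  length (filterᵇ (changed G G' u) (V G))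
  + length (filterᵇ (λ w → not (inV G w) ∧ changed G G' u w) (V G'))

BoundedBatch : ℕ → Graph → Graph → Set
BoundedBatch d G G' = ∀ u → T (inV G' u) → updatesAt G G' u ≤ d

IDsFit : ℕ → Graph → Set
IDsFit κ G = ∀ u → T (inV G u) → u < 2 ^ (κ * (⌈log₂ size G ⌉ + 1))

Msg : Set
Msg = List Bool

Triple : Set
Triple = ℕ × ℕ × ℕ

record Algorithm : Set₁ where
  field
    State : Set
    -- initial state of node v of G₀: knows the complete topology of G₀ and its ID
    init  : Graph → ℕ → State
    -- state of a freshly inserted node v: knows only its ID
    fresh : ℕ → State
    -- message sent (given the state before the round and the new
    -- neighbor list) to the neighbor with the given ID
    send  : State → List ℕ → ℕ → Msg
    -- new state after receiving the messages (indexed by sender ID)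
    recv  : State → List ℕ → (ℕ → Msg) → State
    out   : State → List Triple

open Algorithm public

module Run (A : Algorithm) (G : ℕ → Graph) where
  mutual
    -- state of node v after round i (round 0 = initial knowledge of G₀)
    state : ℕ → ℕ → State A
    state zero v = init A (G zero) v
    state (suc i) v =
      recv A (pre i v) (nbrs (G (suc i)) v) (λ w → message i w v)

    pre : ℕ → ℕ → State A
    pre i v = if inV (G i) v then state i v else fresh A v

    -- message from w to v in round i+1 (empty if not neighbours)
    message : ℕ → ℕ → ℕ → Msg
    message i w v =
      if adj (G (suc i)) w v then send A (pre i w) (nbrs (G (suc i)) w) v else []

  -- output of node v in round i+1
  output : ℕ → ℕ → List Triple
  output i v = out A (state (suc i) v)

IsTriangle : Graph → ℕ → ℕ → ℕ → Set
IsTriangle G a b c = T (adj G a b) × T (adj G b c) × T (adj G a c)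

TriangleT : Graph → Triple → Set
TriangleT G (a , b , c) = IsTriangle G a b c

nodesOf : Triple → List ℕ
nodesOf (a , b , c) = a ∷ b ∷ c ∷ []

ListsSet : Triple → ℕ → ℕ → ℕ → Set
ListsSet t a b c = (∀ x → x ∈ nodesOf t → x ∈ nodesOf (a , b , c))
                 × (∀ x → x ∈ nodesOf (a , b , c) → x ∈ nodesOf t)

Admissible : ℕ → ℕ → (ℕ → Graph) → Set
Admissible d κ G = (∀ i → BoundedBatch d (G i) (G (suc i))) × (∀ i → IDsFit κ (G i))

Bandwidth : Algorithm → (ℕ → Graph) → ℕ → Set
Bandwidth A G c = ∀ i u v → T (inV (G (suc i)) u) → T (adj (G (suc i)) u v) →
  length (Run.message A G i u v) ≤ c * (⌈log₂ size (G (suc i)) ⌉ + 1)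

ListsTriangles : Algorithm → (ℕ → Graph) → Set
ListsTriangles A G = ∀ i →
  (∀ u t → T (inV (G (suc i)) u) → t ∈ Run.output A G i u → TriangleT (G (suc i)) t)
  ×
  (∀ a b c → IsTriangle (G (suc i)) a b c →
     ∃[ x ] ((x ≡ a ⊎ x ≡ b ⊎ x ≡ c) ×
             ∃[ t ] (t ∈ Run.output A G i x × ListsSet t a b c)))

-- Every node keeps its neighbour list and the set of edges it knows among
-- its neighbours.  In each round a node tells every neighbour which of its
-- incident edges appeared and which disappeared; since a batch changes O(1)
-- edges at a node, these two lists have O(1) entries of O(log n) bits.  A
-- node knows the edge xy of the triangle wxy iff xy is at least as young as
-- wx and wy, so the vertex opposite the youngest edge of a triangle lists it:
-- when that edge appears, the vertex hears about it from an endpoint, and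
-- afterwards the only way to lose the knowledge is a deletion of xy, which
-- is reported by an endpoint as well.
module Submission where

open import Defs hiding (sym)
open import Data.Bool using (Bool; true; false; T; not; _∧_; _xor_; if_then_else_)
open import Data.Bool.Properties using (T?; T-∧)
open import Data.Empty using (⊥-elim)
open import Data.List
  using (List; []; _∷_; length; _++_; map; filter; filterᵇ; cartesianProduct)
open import Data.List.Properties using (length-++; ++-assoc; ++-identityʳ; filter-none)
open import Data.List.Membership.Propositional using (_∈_; _∉_)
open import Data.List.Membership.Propositional.Properties
  using (∈-++⁺ˡ; ∈-++⁺ʳ; ∈-++⁻; ∈-∃++; ∈-filter⁺; ∈-filter⁻;
         ∈-map∘filter⁺; ∈-map∘filter⁻; ∈-cartesianProduct⁺)
open import Data.List.Relation.Binary.Subset.Propositional using (_⊆_)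
open import Data.List.Relation.Binary.Permutation.Propositional using (_↭_; prep; swap; ↭-refl; ↭-trans; ↭-sym)
open import Data.List.Relation.Binary.Permutation.Propositional.Properties using (∈-resp-↭)
open import Data.List.Relation.Unary.All as All using ()
open import Data.List.Relation.Unary.Any as Any using (here; there)
open import Data.List.Relation.Unary.Any.Properties using (any⁺; any⁻)
open import Data.List.Relation.Unary.AllPairs as AllPairs using (_∷_)
open import Data.List.Relation.Unary.Linked.Properties using (Linked⇒AllPairs)
open import Data.List.Relation.Unary.Unique.Propositional using (Unique)
import Data.List.Relation.Unary.Unique.Propositional.Properties as Unique
open import Data.Nat
open import Data.List.Membership.DecPropositional _≟_ using (_∈?_; _∉?_)
open import Data.Nat.Binary using (ℕᵇ; zero; 2[1+_]; 1+[2_]; toℕ; fromℕ)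
open import Data.Nat.Binary.Properties using (toℕ-fromℕ)
open import Data.Nat.Logarithm using (⌈log₂_⌉)
open import Data.Nat.Properties
open import Data.Nat.Tactic.RingSolver using (solve-∀)
open import Data.Product using (_×_; _,_; proj₁; proj₂; ∃-syntax; map₁; uncurry)
open import Data.Sum as Sum using (_⊎_; inj₁; inj₂; [_,_])
open import Function using (_∘_; id; Equivalence)
open import Relation.Binary.PropositionalEquality hiding ([_])
open import Relation.Binary using (tri<; tri≈; tri>)
open import Relation.Nullary using (¬_; yes; no)
open import Relation.Nullary.Decidable using (Dec; ⌊_⌋; toWitness; fromWitness; ¬?; _×-dec_; _⊎-dec_)

if-T : ∀ {A : Set} {b} {x y : A} → T b → (if b then x else y) ≡ x
if-T {b = true} _ = refl

if-¬T : ∀ {A : Set} {b} {x y : A} → ¬ T b → (if b then x else y) ≡ y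
if-¬T {b = true}  ¬b = ⊥-elim (¬b _)
if-¬T {b = false} _  = refl

¬T⇒T-not : ∀ {b} → ¬ T b → T (not b)
¬T⇒T-not {true}  ¬b = ¬b _
¬T⇒T-not {false} _  = _

T-xor-lost : ∀ {b c} → T b → ¬ T c → T (b xor c)
T-xor-lost {true} _ ¬c = ¬T⇒T-not ¬c

T-xor-gained : ∀ {b c} → ¬ T b → T c → T (b xor c)
T-xor-gained {true}  ¬b _ = ⊥-elim (¬b _)
T-xor-gained {false} _  c = c

T-inList⇒∈ : ∀ {v} xs → T (inList v xs) → v ∈ xs
T-inList⇒∈ {v} xs = Any.map (≡ᵇ⇒≡ v _) ∘ any⁻ _ xs

∈⇒T-inList : ∀ {v xs} → v ∈ xs → T (inList v xs)
∈⇒T-inList {v} = any⁺ _ ∘ Any.map (≡⇒≡ᵇ v _)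

Unique-⊆⇒length≤ : ∀ {A : Set} {xs ys : List A} → Unique xs → xs ⊆ ys → length xs ≤ length ys
Unique-⊆⇒length≤ {xs = []} _ _ = z≤n
Unique-⊆⇒length≤ {xs = x ∷ xs} {ys} (x∉xs ∷ unique) x∷xs⊆ys
  with ys₁ , ys₂ , refl ← ∈-∃++ (x∷xs⊆ys (here refl)) = begin
    suc (length xs)              ≤⟨ s≤s (Unique-⊆⇒length≤ unique xs⊆ys₁++ys₂) ⟩
    suc (length (ys₁ ++ ys₂))    ≡⟨ cong suc (length-++ ys₁) ⟩
    suc (length ys₁ + length ys₂) ≡⟨ sym (+-suc (length ys₁) (length ys₂)) ⟩
    length ys₁ + suc (length ys₂) ≡⟨ sym (length-++ ys₁) ⟩
    length (ys₁ ++ x ∷ ys₂)      ∎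
  where
  open ≤-Reasoning
  xs⊆ys₁++ys₂ : xs ⊆ ys₁ ++ ys₂
  xs⊆ys₁++ys₂ {z} z∈xs with ∈-++⁻ ys₁ (x∷xs⊆ys (there z∈xs))
  ... | inj₁ z∈ys₁        = ∈-++⁺ˡ z∈ys₁
  ... | inj₂ (here refl)  = ⊥-elim (All.lookup x∉xs z∈xs refl)
  ... | inj₂ (there z∈ys₂) = ∈-++⁺ʳ ys₁ z∈ys₂

-- Each constructor of ℕᵇ is sent as the pair 1b; the pair 01 ends a number
-- and 00 ends a list.
codeᵇ : ℕᵇ → List Bool
codeᵇ zero     = false ∷ true ∷ []
codeᵇ 2[1+ x ] = true ∷ false ∷ codeᵇ x
codeᵇ 1+[2 x ] = true ∷ true ∷ codeᵇ x

codeList : List ℕ → List Bool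
codeList []       = false ∷ false ∷ []
codeList (y ∷ ys) = codeᵇ (fromℕ y) ++ codeList ys

-- The first argument is the context formed by the constructors of the number
-- read so far.
decodeList : (ℕᵇ → ℕᵇ) → List Bool → List ℕ × List Bool
decodeList k (true ∷ false ∷ bs)  = decodeList (k ∘ 2[1+_]) bs
decodeList k (true ∷ true ∷ bs)   = decodeList (k ∘ 1+[2_]) bs
decodeList k (false ∷ true ∷ bs)  = map₁ (toℕ (k zero) ∷_) (decodeList id bs)
decodeList k (false ∷ false ∷ bs) = [] , bs
decodeList k _                    = [] , []

decodeList-codeᵇ : ∀ x k bs →
  decodeList k (codeᵇ x ++ bs) ≡ map₁ (toℕ (k x) ∷_) (decodeList id bs)
decodeList-codeᵇ zero     k bs = refl
decodeList-codeᵇ 2[1+ x ] k bs = decodeList-codeᵇ x (k ∘ 2[1+_]) bs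
decodeList-codeᵇ 1+[2 x ] k bs = decodeList-codeᵇ x (k ∘ 1+[2_]) bs

decodeList-codeList : ∀ ys bs → decodeList id (codeList ys ++ bs) ≡ (ys , bs)
decodeList-codeList []       bs = refl
decodeList-codeList (y ∷ ys) bs = begin
  decodeList id ((codeᵇ (fromℕ y) ++ codeList ys) ++ bs)
    ≡⟨ cong (decodeList id) (++-assoc (codeᵇ (fromℕ y)) (codeList ys) bs) ⟩
  decodeList id (codeᵇ (fromℕ y) ++ codeList ys ++ bs)
    ≡⟨ decodeList-codeᵇ (fromℕ y) id (codeList ys ++ bs) ⟩
  map₁ (toℕ (fromℕ y) ∷_) (decodeList id (codeList ys ++ bs))
    ≡⟨ cong₂ (λ z r → map₁ (z ∷_) r) (toℕ-fromℕ y) (decodeList-codeList ys bs) ⟩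
  (y ∷ ys , bs) ∎
  where open ≡-Reasoning

encodePair : List ℕ → List ℕ → List Bool
encodePair xs ys = codeList xs ++ codeList ys

decodePair : List Bool → List ℕ × List ℕ
decodePair bs = proj₁ (decodeList id bs) , proj₁ (decodeList id (proj₂ (decodeList id bs)))

decodePair-encodePair : ∀ xs ys → decodePair (encodePair xs ys) ≡ (xs , ys)
decodePair-encodePair xs ys
  rewrite decodeList-codeList xs (codeList ys)
        | sym (++-identityʳ (codeList ys))
        | decodeList-codeList ys [] = refl

length-codeᵇ : ∀ x k → toℕ x < 2 ^ k → length (codeᵇ x) ≤ 2 + 2 * k
length-codeᵇ zero k _ = m≤m+n 2 (2 * k)
length-codeᵇ 2[1+ x ] zero (s≤s ())
length-codeᵇ 1+[2 x ] zero (s≤s ())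
length-codeᵇ 2[1+ x ] (suc k) x< = s≤s (s≤s (≤-trans
  (length-codeᵇ x k (*-cancelˡ-< 2 _ _ (<-trans (*-monoʳ-< 2 (n<1+n _)) x<)))
  (≤-reflexive (sym (*-suc 2 k)))))
length-codeᵇ 1+[2 x ] (suc k) x< = s≤s (s≤s (≤-trans
  (length-codeᵇ x k (*-cancelˡ-< 2 _ _ (<-trans (n<1+n _) x<)))
  (≤-reflexive (sym (*-suc 2 k)))))

length-codeList : ∀ k ys → (∀ {y} → y ∈ ys → y < 2 ^ k) →
  length (codeList ys) ≤ length ys * (2 + 2 * k) + 2
length-codeList k []       _   = ≤-refl
length-codeList k (y ∷ ys) ys< = begin
  length (codeᵇ (fromℕ y) ++ codeList ys)
    ≡⟨ length-++ (codeᵇ (fromℕ y)) ⟩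
  length (codeᵇ (fromℕ y)) + length (codeList ys)
    ≤⟨ +-mono-≤ (length-codeᵇ (fromℕ y) k (subst (_< 2 ^ k) (sym (toℕ-fromℕ y)) (ys< (here refl))))
                (length-codeList k ys (ys< ∘ there)) ⟩
  (2 + 2 * k) + (length ys * (2 + 2 * k) + 2)
    ≡⟨ sym (+-assoc (2 + 2 * k) _ 2) ⟩
  length (y ∷ ys) * (2 + 2 * k) + 2 ∎
  where open ≤-Reasoning

module _ (H : Graph) where

  adj-sym : ∀ {u v} → T (adj H u v) → T (adj H v u)
  adj-sym {u} {v} = subst T (Graph.sym H u v)

  adj-irrefl : ∀ {u} → ¬ T (adj H u u)
  adj-irrefl {u} = subst T (irrefl H u)

  adj⇒∈V : ∀ {u v} → T (adj H u v) → u ∈ V H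
  adj⇒∈V {u} {v} = T-inList⇒∈ (V H) ∘ adj-V H u v

  ∈-nbrs⁺ : ∀ {u v} → T (adj H u v) → v ∈ nbrs H u
  ∈-nbrs⁺ {u} uv = ∈-filter⁺ (T? ∘ adj H u) (adj⇒∈V (adj-sym uv)) uv

  ∈-nbrs⁻ : ∀ {u v} → v ∈ nbrs H u → T (adj H u v)
  ∈-nbrs⁻ {u} = proj₂ ∘ ∈-filter⁻ (T? ∘ adj H u) {xs = V H}

  Unique-V : Unique (V H)
  Unique-V = AllPairs.map <⇒≢ (Linked⇒AllPairs <-trans (sorted H))

  Unique-nbrs : ∀ u → Unique (nbrs H u)
  Unique-nbrs u = Unique.filter⁺ (T? ∘ adj H u) Unique-V

  nbrs-outside : ∀ {u} → ¬ T (inV H u) → nbrs H u ≡ []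
  nbrs-outside {u} u∉V = filter-none (T? ∘ adj H u) {xs = V H} (All.tabulate (λ {v} _ → u∉V ∘ adj-V H u v))

IsTriangle-swap : ∀ H {a b c} → IsTriangle H a b c → IsTriangle H b a c
IsTriangle-swap H (ab , bc , ac) = adj-sym H ab , ac , bc

IsTriangle-rotate : ∀ H {a b c} → IsTriangle H a b c → IsTriangle H c a b
IsTriangle-rotate H (ab , bc , ac) = adj-sym H ac , ab , adj-sym H bc

updates : Graph → Graph → ℕ → List ℕ
updates H H' u = filterᵇ (changed H H' u) (V H)
              ++ filterᵇ (λ w → not (inV H w) ∧ changed H H' u w) (V H')

length-updates : ∀ H H' u → length (updates H H' u) ≡ updatesAt H H' u
length-updates H H' u = length-++ (filterᵇ (changed H H' u) (V H))

lost-∈-updates : ∀ H H' {u y} → T (adj H u y) → ¬ T (adj H' u y) → y ∈ updates H H' u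
lost-∈-updates H H' {u} uy ¬uy' =
  ∈-++⁺ˡ (∈-filter⁺ (T? ∘ changed H H' u) (adj⇒∈V H (adj-sym H uy)) (T-xor-lost uy ¬uy'))

gained-∈-updates : ∀ H H' {u y} → ¬ T (adj H u y) → T (adj H' u y) → y ∈ updates H H' u
gained-∈-updates H H' {u} {y} ¬uy uy' with T? (inV H y)
... | yes y∈V = ∈-++⁺ˡ (∈-filter⁺ (T? ∘ changed H H' u) (T-inList⇒∈ (V H) y∈V) (T-xor-gained ¬uy uy'))
... | no  y∉V = ∈-++⁺ʳ (filterᵇ (changed H H' u) (V H))
  (∈-filter⁺ (λ w → T? (not (inV H w) ∧ changed H H' u w)) (adj⇒∈V H' (adj-sym H' uy'))
    (Equivalence.from T-∧ (¬T⇒T-not y∉V , T-xor-gained ¬uy uy')))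

record NodeState : Set where
  field
    self       : ℕ
    neighbours : List ℕ
    knows      : ℕ → ℕ → Bool

open NodeState

inserted : NodeState → List ℕ → List ℕ
inserted s N = filter (_∉? neighbours s) N

-- Only the larger endpoint reports a deleted edge: the other endpoint may
-- have left the network, and its ID is bounded only in terms of the old n.
deleted : NodeState → List ℕ → List ℕ
deleted s N = filter (λ y → y <? self s ×-dec y ∉? N) (neighbours s)

∈-inserted⁺ : ∀ s N {y} → y ∈ N → y ∉ neighbours s → y ∈ inserted s N
∈-inserted⁺ s N = ∈-filter⁺ (_∉? neighbours s)

∈-inserted⁻ : ∀ s N {y} → y ∈ inserted s N → y ∈ N × y ∉ neighbours s
∈-inserted⁻ s N = ∈-filter⁻ (_∉? neighbours s) {xs = N}

∈-deleted⁺ : ∀ s N {y} → y ∈ neighbours s → y < self s → y ∉ N → y ∈ deleted s N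
∈-deleted⁺ s N y∈ y< y∉ = ∈-filter⁺ (λ y → y <? self s ×-dec y ∉? N) y∈ (y< , y∉)

∈-deleted⁻ : ∀ s N {y} → y ∈ deleted s N → y ∈ neighbours s × y < self s × y ∉ N
∈-deleted⁻ s N = ∈-filter⁻ (λ y → y <? self s ×-dec y ∉? N) {xs = neighbours s}

Inserted Deleted : (ℕ → Msg) → ℕ → List ℕ
Inserted m x = proj₁ (decodePair (m x))
Deleted  m x = proj₂ (decodePair (m x))

Gone : (ℕ → Msg) → ℕ → ℕ → Set
Gone m x y = y ∈ Deleted m x ⊎ x ∈ Deleted m y

EdgeEvidence : NodeState → (ℕ → Msg) → ℕ → ℕ → Set
EdgeEvidence s m x y = y ∈ Inserted m x ⊎ ¬ Gone m x y × T (knows s x y)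

Learns : NodeState → List ℕ → (ℕ → Msg) → ℕ → ℕ → Set
Learns s N m x y = x ∈ N × y ∈ N × EdgeEvidence s m x y

gone? : ∀ m x y → Dec (Gone m x y)
gone? m x y = y ∈? Deleted m x ⊎-dec x ∈? Deleted m y

learns? : ∀ s N m x y → Dec (Learns s N m x y)
learns? s N m x y = x ∈? N ×-dec y ∈? N ×-dec (y ∈? Inserted m x ⊎-dec ¬? (gone? m x y) ×-dec T? (knows s x y))

triangle? : ∀ H a b c → Dec (IsTriangle H a b c)
triangle? H a b c = T? (adj H a b) ×-dec T? (adj H b c) ×-dec T? (adj H a c)

pairs : NodeState → List (ℕ × ℕ)
pairs s = cartesianProduct (neighbours s) (neighbours s)

triangleListing : Algorithm
triangleListing = record
  { State = NodeState
  ; init  = λ H v → record { self = v ; neighbours = nbrs H v ; knows = λ x y → ⌊ triangle? H v x y ⌋ }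
  ; fresh = λ v → record { self = v ; neighbours = [] ; knows = λ _ _ → false }
  ; send  = λ s N _ → encodePair (inserted s N) (deleted s N)
  ; recv  = λ s N m → record { self = self s ; neighbours = N ; knows = λ x y → ⌊ learns? s N m x y ⌋ }
  ; out   = λ s → map (self s ,_) (filter (T? ∘ uncurry (knows s)) (pairs s))
  }

∈-out⁺ : ∀ s {x y} → x ∈ neighbours s → y ∈ neighbours s → T (knows s x y) →
  (self s , x , y) ∈ out triangleListing s
∈-out⁺ s x∈ y∈ k = ∈-map∘filter⁺ (self s ,_) (T? ∘ uncurry (knows s)) (_ , ∈-cartesianProduct⁺ x∈ y∈ , refl , k)

∈-out⁻ : ∀ s {t} → t ∈ out triangleListing s → ∃[ x ] ∃[ y ] (t ≡ (self s , x , y) × T (knows s x y))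
∈-out⁻ s t∈
  with (x , y) , _ , t≡ , k ← ∈-map∘filter⁻ (self s ,_) (T? ∘ uncurry (knows s)) {xs = pairs s} t∈ =
  x , y , t≡ , k

module Correctness (G : ℕ → Graph) where
  open Run triangleListing G

  Knows : ℕ → ℕ → ℕ → ℕ → Set
  Knows i w x y = T (knows (state i w) x y)

  incoming : ℕ → ℕ → ℕ → Msg
  incoming i w x = message i x w

  pre≡state : ∀ {i v} → T (inV (G i) v) → pre i v ≡ state i v
  pre≡state = if-T

  pre≡fresh : ∀ {i v} → ¬ T (inV (G i) v) → pre i v ≡ fresh triangleListing v
  pre≡fresh = if-¬T

  self-state : ∀ i v → self (state i v) ≡ v
  self-pre : ∀ i v → self (pre i v) ≡ v

  self-state zero    v = refl
  self-state (suc i) v = self-pre i v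

  self-pre i v with T? (inV (G i) v)
  ... | yes v∈V = trans (cong self (pre≡state v∈V)) (self-state i v)
  ... | no  v∉V = cong self (pre≡fresh v∉V)

  neighbours-state : ∀ i v → neighbours (state i v) ≡ nbrs (G i) v
  neighbours-state zero    v = refl
  neighbours-state (suc i) v = refl

  neighbours-pre : ∀ i v → neighbours (pre i v) ≡ nbrs (G i) v
  neighbours-pre i v with T? (inV (G i) v)
  ... | yes v∈V = trans (cong neighbours (pre≡state v∈V)) (neighbours-state i v)
  ... | no  v∉V = trans (cong neighbours (pre≡fresh v∉V)) (sym (nbrs-outside (G i) v∉V))

  ∈-neighbours-pre⁺ : ∀ {i v y} → T (adj (G i) v y) → y ∈ neighbours (pre i v)
  ∈-neighbours-pre⁺ {i} {v} vy = subst (_ ∈_) (sym (neighbours-pre i v)) (∈-nbrs⁺ (G i) vy)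

  ∈-neighbours-pre⁻ : ∀ {i v y} → y ∈ neighbours (pre i v) → T (adj (G i) v y)
  ∈-neighbours-pre⁻ {i} {v} = ∈-nbrs⁻ (G i) ∘ subst (_ ∈_) (neighbours-pre i v)

  module _ {i w x} (wx : T (adj (G (suc i)) w x)) where
    private
      G' = G (suc i)
      s = pre i x
      N = nbrs G' x

    decodePair-incoming : decodePair (incoming i w x) ≡ (inserted s N , deleted s N)
    decodePair-incoming = trans (cong decodePair (if-T (adj-sym G' wx))) (decodePair-encodePair _ _)

    ∈-Inserted⇒adj : ∀ {y} → y ∈ Inserted (incoming i w) x → T (adj G' x y)
    ∈-Inserted⇒adj = ∈-nbrs⁻ G' ∘ proj₁ ∘ ∈-inserted⁻ s N ∘ subst (_ ∈_) (cong proj₁ decodePair-incoming)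

    new-edge-Inserted : ∀ {y} → ¬ T (adj (G i) x y) → T (adj G' x y) → y ∈ Inserted (incoming i w) x
    new-edge-Inserted ¬xy xy' = subst (_ ∈_) (sym (cong proj₁ decodePair-incoming))
      (∈-inserted⁺ s N (∈-nbrs⁺ G' xy') (¬xy ∘ ∈-neighbours-pre⁻))

    ∈-Deleted⇒¬adj : ∀ {y} → y ∈ Deleted (incoming i w) x → ¬ T (adj G' x y)
    ∈-Deleted⇒¬adj y∈ xy' =
      proj₂ (proj₂ (∈-deleted⁻ s N (subst (_ ∈_) (cong proj₂ decodePair-incoming) y∈))) (∈-nbrs⁺ G' xy')

    deletion-reported : ∀ {y} → T (adj (G i) x y) → ¬ T (adj G' x y) → y < x → y ∈ Deleted (incoming i w) x
    deletion-reported xy ¬xy' y<x = subst (_ ∈_) (sym (cong proj₂ decodePair-incoming))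
      (∈-deleted⁺ s N (∈-neighbours-pre⁺ xy) (subst (_ <_) (sym (self-pre i x)) y<x) (¬xy' ∘ ∈-nbrs⁻ G'))

  deleted-edge-Gone : ∀ {i w x y} → T (adj (G (suc i)) w x) → T (adj (G (suc i)) w y) →
    T (adj (G i) x y) → ¬ T (adj (G (suc i)) x y) → Gone (incoming i w) x y
  deleted-edge-Gone {i} {w} {x} {y} wx wy xy ¬xy' with <-cmp x y
  ... | tri< x<y _ _ = inj₂ (deletion-reported wy (adj-sym (G i) xy) (¬xy' ∘ adj-sym (G (suc i))) x<y)
  ... | tri≈ _ refl _ = ⊥-elim (adj-irrefl (G i) xy)
  ... | tri> _ _ y<x = inj₁ (deletion-reported wx xy ¬xy' y<x)

  Knows-sound : ∀ i w {x y} → Knows i w x y → IsTriangle (G i) w x y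
  knows-pre-sound : ∀ i w {x y} → T (knows (pre i w) x y) → IsTriangle (G i) w x y
  learnt-adj : ∀ {i w x y} → T (adj (G (suc i)) w x) → T (adj (G (suc i)) w y) →
    EdgeEvidence (pre i w) (incoming i w) x y → T (adj (G (suc i)) x y)

  Knows-sound zero w k = toWitness k
  Knows-sound (suc i) w k with x∈N , y∈N , learnt ← toWitness k =
    wx , learnt-adj wx wy learnt , wy
    where
    wx = ∈-nbrs⁻ (G (suc i)) x∈N
    wy = ∈-nbrs⁻ (G (suc i)) y∈N

  knows-pre-sound i w k with T? (inV (G i) w)
  ... | yes w∈V = Knows-sound i w (subst (λ s → T (knows s _ _)) (pre≡state w∈V) k)
  ... | no  w∉V = ⊥-elim (subst (λ s → T (knows s _ _)) (pre≡fresh w∉V) k)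

  learnt-adj wx wy (inj₁ y∈Inserted) = ∈-Inserted⇒adj wx y∈Inserted
  learnt-adj {i} {w} {x} {y} wx wy (inj₂ (¬gone , knew)) with T? (adj (G (suc i)) x y)
  ... | yes xy' = xy'
  ... | no ¬xy' = ⊥-elim (¬gone (deleted-edge-Gone wx wy (proj₁ (proj₂ (knows-pre-sound i w knew))) ¬xy'))

  Knows⇒knows-pre : ∀ {i a b c} → Knows i a b c → T (knows (pre i a) b c)
  Knows⇒knows-pre {i} {a} {b} {c} k =
    subst (λ s → T (knows s b c)) (sym (pre≡state (∈⇒T-inList (adj⇒∈V (G i) (proj₁ (Knows-sound i a k)))))) k

  Knows-new-edge : ∀ {i a b c} → IsTriangle (G (suc i)) a b c → ¬ T (adj (G i) b c) → Knows (suc i) a b c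
  Knows-new-edge {i} (ab , bc , ac) ¬bc =
    fromWitness (∈-nbrs⁺ (G (suc i)) ab , ∈-nbrs⁺ (G (suc i)) ac , inj₁ (new-edge-Inserted ab ¬bc bc))

  Knows-persists : ∀ {i a b c} → IsTriangle (G (suc i)) a b c → Knows i a b c → Knows (suc i) a b c
  Knows-persists {i} (ab , bc , ac) k =
    fromWitness (∈-nbrs⁺ G' ab , ∈-nbrs⁺ G' ac , inj₂ (¬gone , Knows⇒knows-pre k))
    where
    G' = G (suc i)
    ¬gone = [ (λ c∈Deleted → ∈-Deleted⇒¬adj ab c∈Deleted bc)
            , (λ b∈Deleted → ∈-Deleted⇒¬adj ac b∈Deleted (adj-sym G' bc)) ]

  KnownByAVertex : ℕ → ℕ → ℕ → ℕ → Set
  KnownByAVertex i a b c = Knows i a b c ⊎ Knows i b a c ⊎ Knows i c a b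

  triangle-known : ∀ i {a b c} → IsTriangle (G i) a b c → KnownByAVertex i a b c
  triangle-known zero t = inj₁ (fromWitness t)
  triangle-known (suc i) {a} {b} {c} t
    with T? (adj (G i) b c) | T? (adj (G i) a c) | T? (adj (G i) a b)
  ... | no ¬bc | _      | _      = inj₁ (Knows-new-edge t ¬bc)
  ... | yes _  | no ¬ac | _      = inj₂ (inj₁ (Knows-new-edge bac ¬ac))
    where bac = IsTriangle-swap (G (suc i)) t
  ... | yes _  | yes _  | no ¬ab = inj₂ (inj₂ (Knows-new-edge cab ¬ab))
    where cab = IsTriangle-rotate (G (suc i)) t
  ... | yes bc | yes ac | yes ab =
    Sum.map (Knows-persists t) (Sum.map (Knows-persists bac) (Knows-persists cab)) (triangle-known i (ab , bc , ac))
    where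
    bac = IsTriangle-swap (G (suc i)) t
    cab = IsTriangle-rotate (G (suc i)) t

  ∈-output⁺ : ∀ {i u x y} → Knows (suc i) u x y → (u , x , y) ∈ output i u
  ∈-output⁺ {i} {u} {x} {y} k with ux , _ , uy ← Knows-sound (suc i) u k =
    subst (λ v → (v , x , y) ∈ output i u) (self-state (suc i) u)
      (∈-out⁺ (state (suc i) u) (∈-nbrs⁺ (G (suc i)) ux) (∈-nbrs⁺ (G (suc i)) uy) k)

  output-sound : ∀ {i u t} → t ∈ output i u → TriangleT (G (suc i)) t
  output-sound {i} {u} t∈ with x , y , refl , k ← ∈-out⁻ (state (suc i) u) t∈ =
    subst (λ v → TriangleT (G (suc i)) (v , x , y)) (sym (self-state (suc i) u)) (Knows-sound (suc i) u k)

  ListsSet-↭ : ∀ {t a b c} → nodesOf t ↭ nodesOf (a , b , c) → ListsSet t a b c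
  ListsSet-↭ t↭abc = (λ _ → ∈-resp-↭ t↭abc) , (λ _ → ∈-resp-↭ (↭-sym t↭abc))

  listed-by-a-vertex : ∀ {i a b c} → KnownByAVertex (suc i) a b c →
    ∃[ x ] ((x ≡ a ⊎ x ≡ b ⊎ x ≡ c) × ∃[ t ] (t ∈ output i x × ListsSet t a b c))
  listed-by-a-vertex {a = a} {b} {c} (inj₁ k) =
    a , inj₁ refl , _ , ∈-output⁺ k , ListsSet-↭ ↭-refl
  listed-by-a-vertex {a = a} {b} {c} (inj₂ (inj₁ k)) =
    b , inj₂ (inj₁ refl) , _ , ∈-output⁺ k , ListsSet-↭ (swap b a ↭-refl)
  listed-by-a-vertex {a = a} {b} {c} (inj₂ (inj₂ k)) =
    c , inj₂ (inj₂ refl) , _ , ∈-output⁺ k , ListsSet-↭ (↭-trans (swap c a ↭-refl) (prep a (swap c b ↭-refl)))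

  listsTriangles : ListsTriangles triangleListing G
  listsTriangles i = (λ _ _ _ → output-sound) , λ _ _ _ t → listed-by-a-vertex (triangle-known (suc i) t)

bandwidth-arith : ∀ d κ l →
  (d * (2 + 2 * (κ * (l + 1))) + 2) + (d * (2 + 2 * (κ * (l + 1))) + 2) ≤ (4 * d * κ + 4 * d + 4) * (l + 1)
bandwidth-arith d κ l = ≤-trans (m≤m+n _ ((4 * d + 4) * l)) (≤-reflexive (sym (expand d κ l)))
  where
  expand : ∀ d κ l → (4 * d * κ + 4 * d + 4) * (l + 1)
    ≡ (d * (2 + 2 * (κ * (l + 1))) + 2) + (d * (2 + 2 * (κ * (l + 1))) + 2) + (4 * d + 4) * l
  expand = solve-∀

module Bandwidth (d κ : ℕ) (G : ℕ → Graph) (admissible : Admissible d κ G) where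
  open Run triangleListing G
  open Correctness G

  module _ (i u : ℕ) (u∈V : T (inV (G (suc i)) u)) where
    private
      G' = G (suc i)
      s = pre i u
      N = nbrs G' u
      K = κ * (⌈log₂ size G' ⌉ + 1)

    inserted⊆updates : inserted s N ⊆ updates (G i) G' u
    inserted⊆updates y∈ with y∈N , y∉old ← ∈-inserted⁻ s N y∈ =
      gained-∈-updates (G i) G' (y∉old ∘ ∈-neighbours-pre⁺) (∈-nbrs⁻ G' y∈N)

    deleted⊆updates : deleted s N ⊆ updates (G i) G' u
    deleted⊆updates y∈ with y∈old , _ , y∉N ← ∈-deleted⁻ s N y∈ =
      lost-∈-updates (G i) G' (∈-neighbours-pre⁻ y∈old) (y∉N ∘ ∈-nbrs⁺ G')

    length≤d : ∀ {ys} → Unique ys → ys ⊆ updates (G i) G' u → length ys ≤ d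
    length≤d {ys} unique ys⊆ = begin
      length ys                    ≤⟨ Unique-⊆⇒length≤ unique ys⊆ ⟩
      length (updates (G i) G' u)  ≡⟨ length-updates (G i) G' u ⟩
      updatesAt (G i) G' u         ≤⟨ proj₁ admissible i u u∈V ⟩
      d                            ∎
      where open ≤-Reasoning

    length-inserted : length (inserted s N) ≤ d
    length-inserted = length≤d (Unique.filter⁺ _ (Unique-nbrs G' u)) inserted⊆updates

    length-deleted : length (deleted s N) ≤ d
    length-deleted =
      length≤d (Unique.filter⁺ _ (subst Unique (sym (neighbours-pre i u)) (Unique-nbrs (G i) u))) deleted⊆updates

    inserted-< : ∀ {y} → y ∈ inserted s N → y < 2 ^ K
    inserted-< {y} y∈ =
      proj₂ admissible (suc i) y (∈⇒T-inList (adj⇒∈V G' (adj-sym G' (∈-nbrs⁻ G' (proj₁ (∈-inserted⁻ s N y∈))))))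

    deleted-< : ∀ {y} → y ∈ deleted s N → y < 2 ^ K
    deleted-< y∈ with _ , y<self , _ ← ∈-deleted⁻ s N y∈ =
      <-trans (subst (_ <_) (self-pre i u) y<self) (proj₂ admissible (suc i) u u∈V)

    length-message : ∀ {v} → T (adj G' u v) →
      length (message i u v) ≤ (d * (2 + 2 * K) + 2) + (d * (2 + 2 * K) + 2)
    length-message {v} uv = begin
      length (message i u v)
        ≡⟨ cong length (if-T uv) ⟩
      length (codeList (inserted s N) ++ codeList (deleted s N))
        ≡⟨ length-++ (codeList (inserted s N)) ⟩
      length (codeList (inserted s N)) + length (codeList (deleted s N))
        ≤⟨ +-mono-≤ (length-codeList K _ inserted-<) (length-codeList K _ deleted-<) ⟩
      (length (inserted s N) * (2 + 2 * K) + 2) + (length (deleted s N) * (2 + 2 * K) + 2)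
        ≤⟨ +-mono-≤ (+-monoˡ-≤ 2 (*-monoˡ-≤ (2 + 2 * K) length-inserted))
                    (+-monoˡ-≤ 2 (*-monoˡ-≤ (2 + 2 * K) length-deleted)) ⟩
      (d * (2 + 2 * K) + 2) + (d * (2 + 2 * K) + 2) ∎
      where open ≤-Reasoning

  bandwidth : Bandwidth triangleListing G (4 * d * κ + 4 * d + 4)
  bandwidth i u v u∈V uv = ≤-trans (length-message i u u∈V uv) (bandwidth-arith d κ _)

theorem3 : ∀ (d κ : ℕ) → ∃[ A ] ∃[ c ]
    (∀ (G : ℕ → Graph) → Admissible d κ G → Bandwidth A G c × ListsTriangles A G)
theorem3 d κ = triangleListing , 4 * d * κ + 4 * d + 4 , λ G admissible →
  Bandwidth.bandwidth d κ G admissible , Correctness.listsTriangles G
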